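{- Let $G=(V^+,V^-;E)$ be a bipartite graph with $|V^+|\le|V^-|$ and $|V^-|\ge2$. Then $G$ is DM-irreducible if and only if $|\Gamma_G(X^+)|\ge|X^+|+1$ for every nonempty $X^+\subseteq V^+$ with $|X^+|<|V^-|$.
   Context: A bipartite graph $G=(V^+,V^-;E)$ has finite disjoint vertex sides $V^+,V^-$, and its edge set satisfies $E\subseteq V^+\times V^-$. For $X\subseteq V^+$, $\Gamma_G(X)$ is the set of vertices of $V^-$ adjacent to some vertex of $X$. DM-decomposition. Define $f_G(X)=|\Gamma_G(X)|-|X|$ for $X\subseteq V^+$. Its minimizers form a lattice under union and intersection. Take a maximal chain $X_0\subsetneq\cdots\subsetneq X_k$ of minimizers and set: - $V_0=X_0\cup\Gamma_G(X_0)$; - $V_i=(X_i\setminus X_{i-1})\cup(\Gamma_G(X_i)\setminus\Gamma_G(X_{i-1}))$ for $i=1,\dots,k$; - $V_\infty=(V^+\setminus X_k)\cup(V^-\setminus\Gamma_G(X_k))$. This partition of $V=V^+\cup V^-$ is independent of the chain. $G$ is DM-irreducible if exactly one part is nonempty, i.e. $V_0=V$, or $V_1=V$, or $V_\infty=V$. -}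

module Defs where

open import Data.Nat using (ℕ; suc; _≤_)
open import Data.Integer as ℤ using (ℤ; +_; _-_)
open import Data.Bool using (Bool; _∧_)
open import Data.Fin using (Fin; zero; suc; inject₁; fromℕ; toℕ)
open import Data.Fin.Subset using (Subset; ⊤; ∁; _─_; _⊆_; _⊂_; ∣_∣)
open import Data.Vec using (tabulate; lookup)
open import Data.List using (allFin)
open import Data.Bool.ListAction using (any)
open import Data.Product using (Σ; _×_; _,_; ∃-syntax)
open import Data.Sum using (_⊎_)
open import Relation.Binary.PropositionalEquality using (_≡_)

-- A bipartite graph G = (V⁺, V⁻; E) with V⁺ = Fin m, V⁻ = Fin n,
-- edge relation E ⊆ V⁺ × V⁻ given as a Boolean-valued relation.
BipGraph : ℕ → ℕ → Set
BipGraph m n = Fin m → Fin n → Bool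

module _ {m n : ℕ} (E : BipGraph m n) where

  Γ : Subset m → Subset n
  Γ X = tabulate (λ j → any (λ i → lookup X i ∧ E i j) (allFin m))

  f : Subset m → ℤ
  f X = + ∣ Γ X ∣ - + ∣ X ∣

  IsMinimizer : Subset m → Set
  IsMinimizer X = ∀ (Y : Subset m) → f X ℤ.≤ f Y

  record MinChain : Set where
    field
      k      : ℕ
      X      : Fin (suc k) → Subset m
      minim  : ∀ i → IsMinimizer (X i)
      strict : ∀ (i : Fin k) → X (inject₁ i) ⊂ X (suc i)
      maximal : ∀ (Y : Subset m) → IsMinimizer Y →
                (∀ i → (Y ⊆ X i) ⊎ (X i ⊆ Y)) → Σ (Fin (suc k)) (λ i → Y ≡ X i)

  -- the parts of V = V⁺ ∪ V⁻, represented as (part ∩ V⁺ , part ∩ V⁻)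
  module _ (C : MinChain) where
    open MinChain C

    V₀ : Subset m × Subset n
    V₀ = X zero , Γ (X zero)

    Vᵢ : (i : Fin k) → Subset m × Subset n
    Vᵢ i = (X (suc i) ─ X (inject₁ i)) , (Γ (X (suc i)) ─ Γ (X (inject₁ i)))

    V∞ : Subset m × Subset n
    V∞ = ∁ (X (fromℕ k)) , ∁ (Γ (X (fromℕ k)))

  Full : Subset m × Subset n → Set
  Full (A , B) = (A ≡ ⊤) × (B ≡ ⊤)

  -- G is DM-irreducible: for a maximal chain of minimizers (the partition is
  -- independent of the chain), V₀ = V, or V₁ = V, or V∞ = V.
  DMIrreducible : Set
  DMIrreducible = ∃[ C ] (Full (V₀ C) ⊎ (Σ (Fin (MinChain.k C)) (λ i → (toℕ i ≡ 0) × Full (Vᵢ C i))) ⊎ Full (V∞ C))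

-- Write f X = |Γ X| - |X|, so that f ∅ = 0; once ∅ is a minimizer (Hall's condition), the
-- minimizers of f are exactly the sets X with |Γ X| ≤ |X|.
-- (⇐) If m < n, every nonempty X has surplus, ∅ is the only minimizer and the chain {∅}
-- has V∞ = V. If m = n ≥ 2, the surplus of V⁺ minus one vertex forces Γ V⁺ = V⁻, so the
-- minimizers are exactly ∅ and V⁺ and the chain ∅ ⊂ V⁺ has V₁ = V.
-- (⇒) If V₀ = V, then f X₀ ≥ 0 = f ∅ because Γ X₀ = V⁻, so ∅ is a minimizer, lies on the
-- chain below X₀, and n = 0. If Vᵢ = V or V∞ = V, every chain member is ∅ or V⁺ and ∅ is a
-- minimizer; a nonempty X without surplus is then a minimizer comparable with the whole
-- chain, hence a member of it, which is impossible when |X| < n.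
module Submission where

open import Defs
open import Data.Nat using (ℕ; _≤_; _<_; _+_)
open import Data.Fin.Subset using (Subset; ∣_∣; Nonempty)
open import Function.Bundles using (_⇔_)

open import Algebra.Lattice.Properties.BooleanAlgebra using (¬⊥≈⊤)
open import Data.Bool using (T)
open import Data.Bool.Properties using (T-≡; T-∧)
open import Data.Empty using (⊥-elim)
open import Data.Fin using (Fin; zero; suc; inject₁; fromℕ)
open import Data.Fin.Subset using (⊥; ⊤; ∁; _─_; _∈_; _∉_; _⊆_; _⊂_; outside)
open import Data.Fin.Subset.Properties
  using ( ∪-∩-booleanAlgebra; ∉⊥; ⊥⊆; ∈⊤; ⊆⊤; ⊆-antisym; ∣⊥∣≡0; ∣⊤∣≡n; ∣p∣≤n; ∣p∣≡n⇒p≡⊤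
        ; p⊆q⇒∣p∣≤∣q∣; p─⊥≡p; p─q⊆p; x∈p⇒x∉∁p; Empty-unique; nonempty? )
open import Data.Integer as ℤ using (ℤ; 0ℤ; +_; -_; +≤+)
import Data.Integer.Properties as ℤₚ
open import Data.Integer.Tactic.RingSolver using (solve-∀)
open import Data.List using (allFin)
open import Data.List.Membership.Propositional using (lose)
open import Data.List.Membership.Propositional.Properties using (∈-allFin)
open import Data.List.Relation.Unary.Any using (satisfied)
open import Data.List.Relation.Unary.Any.Properties using (any⁺; any⁻)
open import Data.Nat using (suc; z≤n; s≤s)
open import Data.Nat.Properties
  using ( ≤-refl; ≤-reflexive; ≤-trans; ≤-antisym; ≤-<-trans; <⇒≤; <⇒≱; ≰⇒>; +-comm; +-identityʳ
        ; n≤0⇒n≡0; m≤n⇒m<n∨m≡n; module ≤-Reasoning )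
open import Data.Product using (_×_; _,_; proj₁; proj₂; ∃-syntax)
open import Data.Sum using (_⊎_; inj₁; inj₂; [_,_]′)
open import Data.Vec using (_∷_; there)
open import Data.Vec.Properties using (lookup∘tabulate; []=⇒lookup; lookup⇒[]=)
open import Function using (_∘_)
open import Function.Bundles using (mk⇔; Equivalence)
open import Relation.Binary.PropositionalEquality
open import Relation.Nullary using (¬_; yes; no)

open Equivalence using (to; from)

+-cancelʳ-≤ : ∀ k {i j} → i ℤ.+ k ℤ.≤ j ℤ.+ k → i ℤ.≤ j
+-cancelʳ-≤ k {i} {j} le = subst₂ ℤ._≤_ (cancel i k) (cancel j k) (ℤₚ.+-monoˡ-≤ (- k) le)
  where
  cancel : ∀ x y → x ℤ.+ y ℤ.+ - y ≡ x
  cancel = solve-∀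

[+m]-[+n]≤[+o]-[+p]⇔m+p≤o+n : ∀ m n o p → (+ m ℤ.- + n ℤ.≤ + o ℤ.- + p) ⇔ (m + p ≤ o + n)
[+m]-[+n]≤[+o]-[+p]⇔m+p≤o+n m n o p = mk⇔
  (λ le → ℤₚ.drop‿+≤+ (subst₂ ℤ._≤_ shiftˡ shiftʳ (ℤₚ.+-monoˡ-≤ k le)))
  (λ le → +-cancelʳ-≤ k (subst₂ ℤ._≤_ (sym shiftˡ) (sym shiftʳ) (+≤+ le)))
  where
  k : ℤ
  k = + n ℤ.+ + p
  shiftˡ : (+ m ℤ.- + n) ℤ.+ k ≡ + (m + p)
  shiftˡ = trans (identity (+ m) (+ n) (+ p)) (sym (ℤₚ.pos-+ m p))
    where
    identity : ∀ x y z → (x ℤ.- y) ℤ.+ (y ℤ.+ z) ≡ x ℤ.+ z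
    identity = solve-∀
  shiftʳ : (+ o ℤ.- + p) ℤ.+ k ≡ + (o + n)
  shiftʳ = trans (identity (+ o) (+ n) (+ p)) (sym (ℤₚ.pos-+ o n))
    where
    identity : ∀ x y z → (x ℤ.- z) ℤ.+ (y ℤ.+ z) ≡ x ℤ.+ y
    identity = solve-∀

x∈p─q⇒x∉q : ∀ {n x} {p q : Subset n} → x ∈ p ─ q → x ∉ q
x∈p─q⇒x∉q {p = _ ∷ _} {_ ∷ _} (there x∈p─q) (there x∈q) = x∈p─q⇒x∉q x∈p─q x∈q

module _ {n : ℕ} where

  ⊤⊆p⇒p≡⊤ : ∀ {p : Subset n} → ⊤ ⊆ p → p ≡ ⊤
  ⊤⊆p⇒p≡⊤ ⊤⊆p = ⊆-antisym ⊆⊤ ⊤⊆p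

  p⊆⊥⇒p≡⊥ : ∀ {p : Subset n} → p ⊆ ⊥ → p ≡ ⊥
  p⊆⊥⇒p≡⊥ p⊆⊥ = ⊆-antisym p⊆⊥ ⊥⊆

  p─q≡⊤⇒p≡⊤ : ∀ {p q : Subset n} → p ─ q ≡ ⊤ → p ≡ ⊤
  p─q≡⊤⇒p≡⊤ {p} {q} eq = ⊤⊆p⇒p≡⊤ (λ _ → p─q⊆p p q (subst (_ ∈_) (sym eq) ∈⊤))

  p─q≡⊤⇒q≡⊥ : ∀ {p q : Subset n} → p ─ q ≡ ⊤ → q ≡ ⊥
  p─q≡⊤⇒q≡⊥ eq = Empty-unique (λ (x , x∈q) → x∈p─q⇒x∉q (subst (x ∈_) (sym eq) ∈⊤) x∈q)

  ∁p≡⊤⇒p≡⊥ : ∀ {p : Subset n} → ∁ p ≡ ⊤ → p ≡ ⊥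
  ∁p≡⊤⇒p≡⊥ eq = Empty-unique (λ (x , x∈p) → x∈p⇒x∉∁p x∈p (subst (x ∈_) (sym eq) ∈⊤))

  ∁⊥≡⊤ : ∁ ⊥ ≡ ⊤ {n}
  ∁⊥≡⊤ = ¬⊥≈⊤ (∪-∩-booleanAlgebra n)

  nonempty⇒≢⊥ : ∀ {p : Subset n} → Nonempty p → p ≢ ⊥
  nonempty⇒≢⊥ (x , x∈p) refl = ∉⊥ x∈p

  n≤∣p∣⇒p≡⊤ : ∀ {p : Subset n} → n ≤ ∣ p ∣ → p ≡ ⊤
  n≤∣p∣⇒p≡⊤ {p} n≤∣p∣ = ∣p∣≡n⇒p≡⊤ (≤-antisym (∣p∣≤n p) n≤∣p∣)

  ∣p∣<n⊎p≡⊤ : ∀ (p : Subset n) → ∣ p ∣ < n ⊎ p ≡ ⊤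
  ∣p∣<n⊎p≡⊤ p = [ inj₁ , inj₂ ∘ ∣p∣≡n⇒p≡⊤ ]′ (m≤n⇒m<n∨m≡n (∣p∣≤n p))

Ascending : ∀ {m} k → (Fin (suc k) → Subset m) → Set
Ascending k X = ∀ (i : Fin k) → X (inject₁ i) ⊆ X (suc i)

head⊆ : ∀ {m} k (X : Fin (suc k) → Subset m) → Ascending k X → ∀ i → X zero ⊆ X i
head⊆ k       X asc zero    = λ x∈ → x∈
head⊆ (suc k) X asc (suc i) = λ x∈ → head⊆ k (X ∘ suc) (asc ∘ suc) i (asc zero x∈)

⊆last : ∀ {m} k (X : Fin (suc k) → Subset m) → Ascending k X → ∀ i → X i ⊆ X (fromℕ k)
⊆last k       X asc zero    = head⊆ k X asc (fromℕ k)
⊆last (suc k) X asc (suc i) = ⊆last k (X ∘ suc) (asc ∘ suc) i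

⊆below⊎above⊆ : ∀ {m} k (X : Fin (suc k) → Subset m) → Ascending k X →
                ∀ i j → X j ⊆ X (inject₁ i) ⊎ X (suc i) ⊆ X j
⊆below⊎above⊆ (suc k) X asc i       zero    = inj₁ (head⊆ (suc k) X asc (inject₁ i))
⊆below⊎above⊆ (suc k) X asc zero    (suc j) = inj₂ (head⊆ k (X ∘ suc) (asc ∘ suc) j)
⊆below⊎above⊆ (suc k) X asc (suc i) (suc j) = ⊆below⊎above⊆ k (X ∘ suc) (asc ∘ suc) i j

module _ {m n : ℕ} (E : BipGraph m n) where

  ∈Γ⁻ : ∀ {X j} → j ∈ Γ E X → ∃[ i ] i ∈ X × T (E i j)
  ∈Γ⁻ {X} {j} j∈ΓX
    with satisfied (any⁻ _ (allFin m) (from T-≡ (trans (sym (lookup∘tabulate _ j)) ([]=⇒lookup j∈ΓX))))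
  ... | i , Xi∧Eij with to T-∧ Xi∧Eij
  ...   | Xi , Eij = i , lookup⇒[]= i X (to T-≡ Xi) , Eij

  ∈Γ⁺ : ∀ {X i j} → i ∈ X → T (E i j) → j ∈ Γ E X
  ∈Γ⁺ {X} {i} {j} i∈X Eij = lookup⇒[]= j (Γ E X) (trans (lookup∘tabulate _ j)
    (to T-≡ (any⁺ _ (lose (∈-allFin i) (from T-∧ (from T-≡ ([]=⇒lookup i∈X) , Eij))))))

  Γ-mono : ∀ {X Y} → X ⊆ Y → Γ E X ⊆ Γ E Y
  Γ-mono X⊆Y j∈ΓX with ∈Γ⁻ j∈ΓX
  ... | i , i∈X , Eij = ∈Γ⁺ (X⊆Y i∈X) Eij

  Γ⊥≡⊥ : Γ E ⊥ ≡ ⊥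
  Γ⊥≡⊥ = Empty-unique (λ (j , j∈Γ⊥) → let (i , i∈⊥ , _) = ∈Γ⁻ j∈Γ⊥ in ∉⊥ i∈⊥)

  Surplus : Subset m → Set
  Surplus X = ∣ X ∣ + 1 ≤ ∣ Γ E X ∣

  NoSurplus : Subset m → Set
  NoSurplus X = ∣ Γ E X ∣ ≤ ∣ X ∣

  Hall : Set
  Hall = ∀ X → ∣ X ∣ ≤ ∣ Γ E X ∣

  SurplusCondition : Set
  SurplusCondition = ∀ X → Nonempty X → ∣ X ∣ < n → Surplus X

  surplus⇔< : ∀ X → Surplus X ⇔ ∣ X ∣ < ∣ Γ E X ∣
  surplus⇔< X = mk⇔ (subst (_≤ ∣ Γ E X ∣) (+-comm ∣ X ∣ 1)) (subst (_≤ ∣ Γ E X ∣) (+-comm 1 ∣ X ∣))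

  surplus⇒¬noSurplus : ∀ X → Surplus X → ¬ NoSurplus X
  surplus⇒¬noSurplus X = <⇒≱ ∘ to (surplus⇔< X)

  ¬noSurplus⇒surplus : ∀ X → ¬ NoSurplus X → Surplus X
  ¬noSurplus⇒surplus X = from (surplus⇔< X) ∘ ≰⇒>

  nonempty-hall⇒hall : (∀ X → Nonempty X → ∣ X ∣ ≤ ∣ Γ E X ∣) → Hall
  nonempty-hall⇒hall hall X with nonempty? X
  ... | yes ne = hall X ne
  ... | no ¬ne = subst (_≤ ∣ Γ E X ∣) (sym (trans (cong ∣_∣ (Empty-unique ¬ne)) (∣⊥∣≡0 m))) z≤n

  f⊥≡0 : f E ⊥ ≡ 0ℤ
  f⊥≡0 = cong₂ (λ a b → + a ℤ.- + b) (trans (cong ∣_∣ Γ⊥≡⊥) (∣⊥∣≡0 n)) (∣⊥∣≡0 m)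

  f≤0⇔noSurplus : ∀ X → f E X ℤ.≤ 0ℤ ⇔ NoSurplus X
  f≤0⇔noSurplus X = subst (λ a → f E X ℤ.≤ 0ℤ ⇔ a ≤ ∣ X ∣) (+-identityʳ _)
    ([+m]-[+n]≤[+o]-[+p]⇔m+p≤o+n ∣ Γ E X ∣ ∣ X ∣ 0 0)

  0≤f⇔hall : ∀ X → 0ℤ ℤ.≤ f E X ⇔ ∣ X ∣ ≤ ∣ Γ E X ∣
  0≤f⇔hall X = subst (λ a → 0ℤ ℤ.≤ f E X ⇔ ∣ X ∣ ≤ a) (+-identityʳ _)
    ([+m]-[+n]≤[+o]-[+p]⇔m+p≤o+n 0 0 ∣ Γ E X ∣ ∣ X ∣)

  minimizer⇒noSurplus : ∀ X → IsMinimizer E X → NoSurplus X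
  minimizer⇒noSurplus X minX = to (f≤0⇔noSurplus X) (subst (f E X ℤ.≤_) f⊥≡0 (minX ⊥))

  noSurplus⇒minimizer : IsMinimizer E ⊥ → ∀ X → NoSurplus X → IsMinimizer E X
  noSurplus⇒minimizer min⊥ X tight Y =
    ℤₚ.≤-trans (subst (f E X ℤ.≤_) (sym f⊥≡0) (from (f≤0⇔noSurplus X) tight)) (min⊥ Y)

  hall⇒⊥-minimizer : Hall → IsMinimizer E ⊥
  hall⇒⊥-minimizer hall Y = subst (ℤ._≤ f E Y) (sym f⊥≡0) (from (0≤f⇔hall Y) (hall Y))

  minimizer⇒hall : ∀ X → IsMinimizer E X → ∣ X ∣ ≤ ∣ Γ E X ∣ → Hall
  minimizer⇒hall X minX X-hall Y = to (0≤f⇔hall Y) (ℤₚ.≤-trans (from (0≤f⇔hall X) X-hall) (minX Y))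

  chainOfAllMinimizers : ∀ k (X : Fin (suc k) → Subset m) → (∀ i → IsMinimizer E (X i)) →
                         (∀ (i : Fin k) → X (inject₁ i) ⊂ X (suc i)) →
                         (∀ Y → IsMinimizer E Y → ∃[ i ] Y ≡ X i) → MinChain E
  chainOfAllMinimizers k X minX strict all = record
    { k = k ; X = X ; minim = minX ; strict = strict ; maximal = λ Y minY _ → all Y minY }

  surplus-everywhere⇒irreducible : (∀ X → Nonempty X → Surplus X) → DMIrreducible E
  surplus-everywhere⇒irreducible surplus =
    chainOfAllMinimizers 0 (λ _ → ⊥) (λ _ → min⊥) (λ ()) only-⊥ ,
    inj₂ (inj₂ (∁⊥≡⊤ , trans (cong ∁ Γ⊥≡⊥) ∁⊥≡⊤))
    where
    min⊥ : IsMinimizer E ⊥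
    min⊥ = hall⇒⊥-minimizer (nonempty-hall⇒hall λ X ne → <⇒≤ (to (surplus⇔< X) (surplus X ne)))
    only-⊥ : ∀ Y → IsMinimizer E Y → ∃[ i ] Y ≡ ⊥
    only-⊥ Y minY with nonempty? Y
    ... | yes ne = ⊥-elim (surplus⇒¬noSurplus Y (surplus Y ne) (minimizer⇒noSurplus Y minY))
    ... | no ¬ne = zero , Empty-unique ¬ne

  trivial-minimizers⇒irreducible : Fin m → Hall → Γ E ⊤ ≡ ⊤ → NoSurplus ⊤ →
                                   (∀ Y → NoSurplus Y → Y ≡ ⊥ ⊎ Y ≡ ⊤) → DMIrreducible E
  trivial-minimizers⇒irreducible x hall Γ⊤≡⊤ ⊤-tight trivial =
    chainOfAllMinimizers 1 X minX strict only-⊥-⊤ , inj₂ (inj₁ (zero , refl , p─⊥≡p ⊤ , Γ⊤─Γ⊥≡⊤))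
    where
    X : Fin 2 → Subset m
    X zero    = ⊥
    X (suc _) = ⊤
    min⊥ : IsMinimizer E ⊥
    min⊥ = hall⇒⊥-minimizer hall
    minX : ∀ i → IsMinimizer E (X i)
    minX zero    = min⊥
    minX (suc _) = noSurplus⇒minimizer min⊥ ⊤ ⊤-tight
    strict : ∀ (i : Fin 1) → X (inject₁ i) ⊂ X (suc i)
    strict zero = ⊥⊆ , x , ∈⊤ , ∉⊥
    only-⊥-⊤ : ∀ Y → IsMinimizer E Y → ∃[ i ] Y ≡ X i
    only-⊥-⊤ Y minY = [ (zero ,_) , (suc zero ,_) ]′ (trivial Y (minimizer⇒noSurplus Y minY))
    Γ⊤─Γ⊥≡⊤ : Γ E ⊤ ─ Γ E ⊥ ≡ ⊤
    Γ⊤─Γ⊥≡⊤ = begin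
      Γ E ⊤ ─ Γ E ⊥  ≡⟨ cong (Γ E ⊤ ─_) Γ⊥≡⊥ ⟩
      Γ E ⊤ ─ ⊥      ≡⟨ p─⊥≡p (Γ E ⊤) ⟩
      Γ E ⊤          ≡⟨ Γ⊤≡⊤ ⟩
      ⊤              ∎
      where open ≡-Reasoning

  module _ (C : MinChain E) where

    open MinChain C

    ascending : Ascending k X
    ascending i = proj₁ (strict i)

    noSurplus⇒on-chain : IsMinimizer E ⊥ → (∀ j → X j ≡ ⊥ ⊎ X j ≡ ⊤) →
                         ∀ Y → NoSurplus Y → ∃[ j ] Y ≡ X j
    noSurplus⇒on-chain min⊥ trivial Y tight = maximal Y (noSurplus⇒minimizer min⊥ Y tight) comparable
      where
      comparable : ∀ j → Y ⊆ X j ⊎ X j ⊆ Y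
      comparable j with trivial j
      ... | inj₁ Xj≡⊥ = inj₂ (subst (_⊆ Y) (sym Xj≡⊥) ⊥⊆)
      ... | inj₂ Xj≡⊤ = inj₁ (subst (Y ⊆_) (sym Xj≡⊤) ⊆⊤)

    V₀-full⇒n≡0 : m ≤ n → Full E (V₀ E C) → n ≡ 0
    V₀-full⇒n≡0 m≤n (_ , ΓX₀≡⊤) = n≤0⇒n≡0 (begin
      n                  ≡⟨ ∣ΓX₀∣≡n ⟨
      ∣ Γ E (X zero) ∣   ≤⟨ minimizer⇒noSurplus (X zero) (minim zero) ⟩
      ∣ X zero ∣         ≤⟨ p⊆q⇒∣p∣≤∣q∣ (head⊆ k X ascending j) ⟩
      ∣ X j ∣            ≡⟨ cong ∣_∣ ⊥≡Xj ⟨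
      ∣ ⊥ {m} ∣          ≡⟨ ∣⊥∣≡0 m ⟩
      0                  ∎)
      where
      open ≤-Reasoning
      ∣ΓX₀∣≡n : ∣ Γ E (X zero) ∣ ≡ n
      ∣ΓX₀∣≡n = trans (cong ∣_∣ ΓX₀≡⊤) (∣⊤∣≡n n)
      hall : Hall
      hall = minimizer⇒hall (X zero) (minim zero)
               (≤-trans (∣p∣≤n (X zero)) (subst (m ≤_) (sym ∣ΓX₀∣≡n) m≤n))
      ⊥-on-chain : ∃[ j ] ⊥ ≡ X j
      ⊥-on-chain = maximal ⊥ (hall⇒⊥-minimizer hall) (λ _ → inj₁ ⊥⊆)
      j = proj₁ ⊥-on-chain
      ⊥≡Xj = proj₂ ⊥-on-chain

    Vᵢ-full⇒surplus : ∀ i → Full E (Vᵢ E C i) → SurplusCondition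
    Vᵢ-full⇒surplus i (Xᵢ₊₁─Xᵢ≡⊤ , ΓXᵢ₊₁─ΓXᵢ≡⊤) Y ne ∣Y∣<n = ¬noSurplus⇒surplus Y not-tight
      where
      Xᵢ≡⊥ : X (inject₁ i) ≡ ⊥
      Xᵢ≡⊥ = p─q≡⊤⇒q≡⊥ Xᵢ₊₁─Xᵢ≡⊤
      Xᵢ₊₁≡⊤ : X (suc i) ≡ ⊤
      Xᵢ₊₁≡⊤ = p─q≡⊤⇒p≡⊤ Xᵢ₊₁─Xᵢ≡⊤
      trivial : ∀ j → X j ≡ ⊥ ⊎ X j ≡ ⊤
      trivial j with ⊆below⊎above⊆ k X ascending i j
      ... | inj₁ Xj⊆Xᵢ   = inj₁ (p⊆⊥⇒p≡⊥ (subst (X j ⊆_) Xᵢ≡⊥ Xj⊆Xᵢ))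
      ... | inj₂ Xᵢ₊₁⊆Xj = inj₂ (⊤⊆p⇒p≡⊤ (subst (_⊆ X j) Xᵢ₊₁≡⊤ Xᵢ₊₁⊆Xj))
      not-tight : ¬ NoSurplus Y
      not-tight tight
        with noSurplus⇒on-chain (subst (IsMinimizer E) Xᵢ≡⊥ (minim (inject₁ i))) trivial Y tight
      ... | j , Y≡Xj with trivial j
      ...   | inj₁ Xj≡⊥ = nonempty⇒≢⊥ ne (trans Y≡Xj Xj≡⊥)
      ...   | inj₂ Xj≡⊤ = <⇒≱ ∣Y∣<n (subst (_≤ ∣ Y ∣) ∣ΓY∣≡n tight)
        where
        ∣ΓY∣≡n : ∣ Γ E Y ∣ ≡ n
        ∣ΓY∣≡n = begin
          ∣ Γ E Y ∣           ≡⟨ cong (∣_∣ ∘ Γ E) (trans (trans Y≡Xj Xj≡⊤) (sym Xᵢ₊₁≡⊤)) ⟩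
          ∣ Γ E (X (suc i)) ∣ ≡⟨ cong ∣_∣ (p─q≡⊤⇒p≡⊤ ΓXᵢ₊₁─ΓXᵢ≡⊤) ⟩
          ∣ ⊤ {n} ∣           ≡⟨ ∣⊤∣≡n n ⟩
          n                   ∎
          where open ≡-Reasoning

    V∞-full⇒surplus : Full E (V∞ E C) → ∀ Y → Nonempty Y → Surplus Y
    V∞-full⇒surplus (∁Xₖ≡⊤ , _) Y ne = ¬noSurplus⇒surplus Y not-tight
      where
      Xₖ≡⊥ : X (fromℕ k) ≡ ⊥
      Xₖ≡⊥ = ∁p≡⊤⇒p≡⊥ ∁Xₖ≡⊤
      X≡⊥ : ∀ j → X j ≡ ⊥
      X≡⊥ j = p⊆⊥⇒p≡⊥ (subst (X j ⊆_) Xₖ≡⊥ (⊆last k X ascending j))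
      not-tight : ¬ NoSurplus Y
      not-tight tight
        with noSurplus⇒on-chain (subst (IsMinimizer E) Xₖ≡⊥ (minim (fromℕ k))) (inj₁ ∘ X≡⊥) Y tight
      ... | j , Y≡Xj = nonempty⇒≢⊥ ne (trans Y≡Xj (X≡⊥ j))

  irreducible⇒surplus : m ≤ n → 2 ≤ n → DMIrreducible E → SurplusCondition
  irreducible⇒surplus m≤n 2≤n (C , inj₁ V₀-full) =
    ⊥-elim (<⇒≱ 2≤n (subst (_≤ 1) (sym (V₀-full⇒n≡0 C m≤n V₀-full)) z≤n))
  -- The argument works for every full Vᵢ.
  irreducible⇒surplus _ _ (C , inj₂ (inj₁ (i , _ , Vᵢ-full))) = Vᵢ-full⇒surplus C i Vᵢ-full
  irreducible⇒surplus _ _ (C , inj₂ (inj₂ V∞-full)) X ne _ = V∞-full⇒surplus C V∞-full X ne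

surplus⇒irreducible-square : ∀ {k} (E : BipGraph (2 + k) (2 + k)) → SurplusCondition E → DMIrreducible E
surplus⇒irreducible-square {k} E surplus =
  trivial-minimizers⇒irreducible E zero hall Γ⊤≡⊤ (≤-reflexive (cong ∣_∣ Γ⊤≡⊤)) trivial
  where
  Γ⊤≡⊤ : Γ E ⊤ ≡ ⊤
  Γ⊤≡⊤ = n≤∣p∣⇒p≡⊤ (≤-trans 2+k≤∣ΓZ∣ (p⊆q⇒∣p∣≤∣q∣ (Γ-mono E {Z} {⊤} ⊆⊤)))
    where
    Z : Subset (2 + k)
    Z = outside ∷ ⊤
    ∣Z∣≡1+k : ∣ Z ∣ ≡ 1 + k
    ∣Z∣≡1+k = ∣⊤∣≡n (1 + k)
    2+k≤∣ΓZ∣ : 2 + k ≤ ∣ Γ E Z ∣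
    2+k≤∣ΓZ∣ = subst (_< ∣ Γ E Z ∣) ∣Z∣≡1+k
      (to (surplus⇔< E Z) (surplus Z (suc zero , there ∈⊤) (subst (_< 2 + k) (sym ∣Z∣≡1+k) ≤-refl)))
  hall : Hall E
  hall = nonempty-hall⇒hall E hall⁺
    where
    hall⁺ : ∀ X → Nonempty X → ∣ X ∣ ≤ ∣ Γ E X ∣
    hall⁺ X ne with ∣p∣<n⊎p≡⊤ X
    ... | inj₁ ∣X∣<n = <⇒≤ (to (surplus⇔< E X) (surplus X ne ∣X∣<n))
    ... | inj₂ refl  = ≤-reflexive (cong ∣_∣ (sym Γ⊤≡⊤))
  trivial : ∀ Y → NoSurplus E Y → Y ≡ ⊥ ⊎ Y ≡ ⊤
  trivial Y tight with nonempty? Y | ∣p∣<n⊎p≡⊤ Y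
  ... | no ¬ne | _          = inj₁ (Empty-unique ¬ne)
  ... | yes ne | inj₁ ∣Y∣<n = ⊥-elim (surplus⇒¬noSurplus E Y (surplus Y ne ∣Y∣<n) tight)
  ... | yes _  | inj₂ Y≡⊤   = inj₂ Y≡⊤

surplus⇒irreducible : ∀ {m n} (E : BipGraph m n) → m ≤ n → 2 ≤ n → SurplusCondition E → DMIrreducible E
surplus⇒irreducible E m≤n 2≤n surplus with m≤n⇒m<n∨m≡n m≤n
... | inj₁ m<n = surplus-everywhere⇒irreducible E (λ X ne → surplus X ne (≤-<-trans (∣p∣≤n X) m<n))
... | inj₂ refl with 2≤n
...   | s≤s (s≤s _) = surplus⇒irreducible-square E surplus

lemma3p2 : (m n : ℕ) (E : BipGraph m n) → m ≤ n → 2 ≤ n →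
    DMIrreducible E ⇔ (∀ (X : Subset m) → Nonempty X → ∣ X ∣ < n → ∣ X ∣ + 1 ≤ ∣ Γ E X ∣)
lemma3p2 m n E m≤n 2≤n = mk⇔ (irreducible⇒surplus E m≤n 2≤n) (surplus⇒irreducible E m≤n 2≤n)
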